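{- Let $P=([n],\preceq)$ be a poset and $0\le r\le m\le n$. If there is an $r$-error-correcting $P$-code $\mathcal{C}\subseteq F^n$ with $|\mathcal{C}|=2^{n-m}$, then the height of $\widetilde P^r$ (the maximum number of elements of a chain in $\widetilde P^r$) is at most $m-r$.
   Context: $[n]=\{1,\dots,n\}$; subsets of $[n]$ are identified with their characteristic vectors in $F^n=\{0,1\}^n$, and $x+y$ is the symmetric difference. An ideal of $P$ is a set $I\subseteq[n]$ such that $a\in I$ and $b\preceq a$ imply $b\in I$; ${<}X{>}$ is the smallest ideal containing $X$. $\mathcal{I}_P^r$ is the set of ideals of cardinality $r$; $P^r=\bigcup_{J\in\mathcal{I}_P^r}J$ and $\widetilde P^r=P^r\setminus\bigcap_{J\in\mathcal{I}_P^r}J$ (with the induced order). The $P$-weight is $w_P(x)=|{<}x{>}|$ and $\mathcal{B}_P^r=\{x\in F^n: w_P(x)\le r\}$. A $P$-code $\mathcal{C}\subseteq F^n$ is $r$-error-correcting if every $x\in F^n$ has at most one representation $x=c+b$ with $c\in\mathcal{C}$, $b\in\mathcal{B}_P^r$. -}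

module Defs where

open import Level using (0ℓ)

open import Data.Nat using (ℕ; _≤_; _∸_; _^_)
open import Data.Bool using (Bool; _xor_; true; _≟_)
open import Data.Fin using (Fin)
open import Data.Fin.Subset using (Subset; _∈_; _∉_; ∣_∣)
open import Data.Vec using (Vec; zipWith; tabulate; lookup)
open import Data.List using (List; length)
open import Data.List.Relation.Unary.All using (All)
open import Data.List.Relation.Unary.Any using (Any)
open import Data.List.Relation.Unary.AllPairs using (AllPairs)
open import Data.List.Relation.Unary.Unique.Propositional using (Unique)
open import Data.Product using (Σ; _×_; ∃)
open import Data.Sum using (_⊎_)
open import Relation.Nullary using (¬_)
open import Relation.Nullary.Decidable using (⌊_⌋; _×-dec_)
open import Relation.Binary.Core using (Rel)
open import Relation.Binary.Definitions using (Decidable)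
open import Relation.Binary.PropositionalEquality using (_≡_)
open import Data.Fin.Properties using (any?)

-- F^n : binary words of length n, identified with subsets of [n]
F : ℕ → Set
F n = Vec Bool n

_⊕_ : ∀ {n} → F n → F n → F n
_⊕_ = zipWith _xor_

module Poset {n : ℕ} (_≼_ : Rel (Fin n) 0ℓ) (_≼?_ : Decidable _≼_) where

  IsIdeal : Subset n → Set
  IsIdeal I = ∀ a b → a ∈ I → b ≼ a → b ∈ I

  ⟨_⟩ : Subset n → Subset n
  ⟨ X ⟩ = tabulate (λ b → ⌊ any? (λ a → (lookup X a ≟ true) ×-dec (b ≼? a)) ⌋)

  wP : F n → ℕ
  wP x = ∣ ⟨ x ⟩ ∣

  InBall : ℕ → F n → Set
  InBall r x = wP x ≤ r

  IdealOfSize : ℕ → Subset n → Set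
  IdealOfSize r J = IsIdeal J × ∣ J ∣ ≡ r

  InPtilde : ℕ → Fin n → Set
  InPtilde r a = (∃ λ J → IdealOfSize r J × a ∈ J) × ¬ (∀ J → IdealOfSize r J → a ∈ J)

  IsChainIn~P : ℕ → List (Fin n) → Set
  IsChainIn~P r cs = Unique cs × All (InPtilde r) cs × AllPairs (λ a b → a ≼ b ⊎ b ≼ a) cs

  ErrorCorrecting : ∀ {k} → ℕ → (Fin k → F n) → Set
  ErrorCorrecting r C = ∀ i j (b₁ b₂ : F n) → InBall r b₁ → InBall r b₂ →
    C i ⊕ b₁ ≡ C j ⊕ b₂ → (C i ≡ C j) × (b₁ ≡ b₂)

-- Let c₁ ≺ ⋯ ≺ c_L be a chain in P̃^r.  Its top element lies in some ideal J of size r,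
-- which then contains the whole chain, and its bottom element lies outside some ideal J′ of
-- size r, which then misses the whole chain; hence |J ∪ J′| ≥ r + L.  Every word supported on
-- an ideal of size r is in the ball B_P^r, so two codewords x ≠ y agreeing outside J ∪ J′
-- would give x + ((x+y) ∩ J′) = y + ((x+y) ∖ J′), two decompositions of one word.  So the
-- projection of the code onto the coordinates outside J ∪ J′ is injective, whence
-- 2^(n-m) ≤ 2^(n-|J ∪ J′|) and r + L ≤ |J ∪ J′| ≤ m.
module Submission where

open import Defs
open import Level using (0ℓ)
open import Data.Nat using (ℕ; _≤_; _∸_; _^_)
open import Data.Fin using (Fin)
open import Data.List using (List; length)
open import Data.Product using (_×_)
open import Function.Definitions using (Injective)
open import Relation.Binary.Core using (Rel)
open import Relation.Binary.Definitions using (Decidable)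
open import Relation.Binary.Structures using (IsPartialOrder)
open import Relation.Binary.PropositionalEquality using (_≡_)

open import Data.Bool using (Bool; true; false; _xor_) renaming (_≟_ to _≟ᵇ_)
open import Data.Bool.Properties using (xor-same; T-≡)
open import Data.Nat using (suc; _+_; _<_; z≤n; s≤s)
open import Data.Nat.Properties
  using (_≟_; ≤-trans; ≮⇒≥; <⇒≱; +-suc; ^-monoʳ-<; ∸-cancelʳ-≤; m+n≤o⇒m≤o∸n)
open import Data.Fin using (combine) renaming (zero to fzero; suc to fsuc; _<_ to _<ᶠ_)
open import Data.Fin.Properties using (combine-injective; pigeonhole; any?; all?)
  renaming (<⇒≢ to <⇒≢ᶠ)
open import Data.Fin.Subset
  using (Subset; inside; outside; _∈_; _∉_; _⊆_; ∣_∣; ∁; _∪_; _∩_; _─_; ⁅_⁆)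
open import Data.Fin.Subset.Properties
  using (_∈?_; anySubset?; p⊆q⇒∣p∣≤∣q∣; ∣p∣≤n; ∣∁p∣≡n∸∣p∣; x∉p⇒x∈∁p; x∈p∪q⁻;
         p⊆p∪q; q⊆p∪q; x∈⁅y⁆⇒x≡y; ∪-identityʳ; p∩q⊆q; p─q⊆p)
open import Data.Vec using ([]; _∷_; lookup; here; there)
open import Data.Vec.Properties using (lookup-zipWith; lookup∘tabulate; []=⇒lookup; lookup⇒[]=)
open import Data.List using ([]; _∷_)
open import Data.List.Membership.Propositional using () renaming (_∈_ to _∈ₗ_)
open import Data.List.Relation.Unary.All as All using (All; []; _∷_)
open import Data.List.Relation.Unary.AllPairs as AllPairs using (AllPairs; []; _∷_)
open import Data.List.Relation.Unary.Any using (here; there)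
open import Data.Product using (_,_; proj₁; proj₂; ∃; ∃₂)
open import Data.Sum using (_⊎_; inj₁; inj₂; [_,_]; swap)
open import Function using (id; flip; _∘_)
open import Function.Bundles using (Equivalence)
open import Relation.Nullary using (Dec; yes; no; contradiction)
open import Relation.Nullary.Decidable using (toWitness; _×-dec_; _→-dec_; ¬?; decidable-stable)
open import Relation.Binary.Definitions using (Reflexive; Transitive)
open import Relation.Binary.PropositionalEquality
  using (refl; sym; trans; cong; subst; _≢_; module ≡-Reasoning)

^-cancelʳ-≤ : ∀ m {a b} → 1 < m → m ^ a ≤ m ^ b → a ≤ b
^-cancelʳ-≤ m 1<m mᵃ≤mᵇ = ≮⇒≥ λ b<a → <⇒≱ (^-monoʳ-< m 1<m b<a) mᵃ≤mᵇ

∣p∪⁅x⁆∣≡1+∣p∣ : ∀ {k} (p : Subset k) {x} → x ∉ p → ∣ p ∪ ⁅ x ⁆ ∣ ≡ suc ∣ p ∣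
∣p∪⁅x⁆∣≡1+∣p∣ (inside  ∷ p) {fzero}  x∉p = contradiction here x∉p
∣p∪⁅x⁆∣≡1+∣p∣ (outside ∷ p) {fzero}  x∉p = cong (suc ∘ ∣_∣) (∪-identityʳ p)
∣p∪⁅x⁆∣≡1+∣p∣ (inside  ∷ p) {fsuc x} x∉p = cong suc (∣p∪⁅x⁆∣≡1+∣p∣ p (x∉p ∘ there))
∣p∪⁅x⁆∣≡1+∣p∣ (outside ∷ p) {fsuc x} x∉p = ∣p∪⁅x⁆∣≡1+∣p∣ p (x∉p ∘ there)

length+∣p∣≤∣q∣ : ∀ {k} {p q : Subset k} (xs : List (Fin k)) → p ⊆ q →
                 AllPairs _≢_ xs → All (_∈ q) xs → All (_∉ p) xs → length xs + ∣ p ∣ ≤ ∣ q ∣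
length+∣p∣≤∣q∣ [] p⊆q _ _ _ = p⊆q⇒∣p∣≤∣q∣ p⊆q
length+∣p∣≤∣q∣ {p = p} {q} (x ∷ xs) p⊆q (x≢xs ∷ distinct) (x∈q ∷ xs⊆q) (x∉p ∷ xs∉p) =
  subst (_≤ ∣ q ∣) length+∣p′∣≡ (length+∣p∣≤∣q∣ xs p′⊆q distinct xs⊆q xs∉p′)
  where
  p′ = p ∪ ⁅ x ⁆

  p′⊆q : p′ ⊆ q
  p′⊆q y∈p′ = [ p⊆q , (λ y∈⁅x⁆ → subst (_∈ q) (sym (x∈⁅y⁆⇒x≡y x y∈⁅x⁆)) x∈q) ] (x∈p∪q⁻ p ⁅ x ⁆ y∈p′)

  xs∉p′ : All (_∉ p′) xs
  xs∉p′ = All.zipWith (λ (x≢y , y∉p) y∈p′ →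
            [ y∉p , (λ y∈⁅x⁆ → x≢y (sym (x∈⁅y⁆⇒x≡y x y∈⁅x⁆))) ] (x∈p∪q⁻ p ⁅ x ⁆ y∈p′))
            (x≢xs , xs∉p)

  length+∣p′∣≡ : length xs + ∣ p′ ∣ ≡ suc (length xs + ∣ p ∣)
  length+∣p′∣≡ = trans
    (cong (length xs +_) (∣p∪⁅x⁆∣≡1+∣p∣ p x∉p)) (+-suc (length xs) ∣ p ∣)

bit : Bool → Fin 2
bit false = fzero
bit true  = fsuc fzero

bit-injective : ∀ {a b} → bit a ≡ bit b → a ≡ b
bit-injective {false} {false} _ = refl
bit-injective {true}  {true}  _ = refl

encodeOn : ∀ {k} (s : Subset k) → F k → Fin (2 ^ ∣ s ∣)
encodeOn []            []      = fzero
encodeOn (outside ∷ s) (_ ∷ x) = encodeOn s x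
encodeOn (inside  ∷ s) (a ∷ x) = combine (bit a) (encodeOn s x)

encodeOn-agree : ∀ {k} (s : Subset k) (x y : F k) → encodeOn s x ≡ encodeOn s y →
                 ∀ {i} → i ∈ s → lookup x i ≡ lookup y i
encodeOn-agree (inside ∷ s) (a ∷ x) (b ∷ y) eq here =
  bit-injective (proj₁ (combine-injective (bit a) _ (bit b) _ eq))
encodeOn-agree (inside ∷ s) (a ∷ x) (b ∷ y) eq (there i∈s) =
  encodeOn-agree s x y (proj₂ (combine-injective (bit a) _ (bit b) _ eq)) i∈s
encodeOn-agree (outside ∷ s) (a ∷ x) (b ∷ y) eq (there i∈s) = encodeOn-agree s x y eq i∈s

AgreeOutside : ∀ {k} → Subset k → F k → F k → Set
AgreeOutside s x y = ∀ {i} → i ∉ s → lookup x i ≡ lookup y i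

pigeonhole-outside : ∀ {k N} (s : Subset k) (f : Fin N → F k) → 2 ^ (k ∸ ∣ s ∣) < N →
                     ∃₂ λ i j → i <ᶠ j × AgreeOutside s (f i) (f j)
pigeonhole-outside {N = N} s f 2^[k∸∣s∣]<N
  with i , j , i<j , same ← pigeonhole (subst (λ e → 2 ^ e < N) (sym (∣∁p∣≡n∸∣p∣ s)) 2^[k∸∣s∣]<N)
                                       (encodeOn (∁ s) ∘ f)
  = i , j , i<j , λ i∉s → encodeOn-agree (∁ s) (f i) (f j) same (x∉p⇒x∈∁p i∉s)

⊕-⊆ : ∀ {k} {s : Subset k} {x y : F k} → AgreeOutside s x y → x ⊕ y ⊆ s
⊕-⊆ {s = s} {x} {y} agree {i} i∈x⊕y with i ∈? s
... | yes i∈s = i∈s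
... | no  i∉s = contradiction x⊕y-true (λ ())
  where
  open ≡-Reasoning
  x⊕y-true : true ≡ false
  x⊕y-true = begin
    true                        ≡⟨ sym ([]=⇒lookup i∈x⊕y) ⟩
    lookup (x ⊕ y) i            ≡⟨ lookup-zipWith _xor_ i x y ⟩
    lookup x i xor lookup y i   ≡⟨ cong (_xor lookup y i) (agree i∉s) ⟩
    lookup y i xor lookup y i   ≡⟨ xor-same (lookup y i) ⟩
    false                       ∎

⊕-split : ∀ {k} (x y s : F k) → x ⊕ ((x ⊕ y) ∩ s) ≡ y ⊕ ((x ⊕ y) ─ s)
⊕-split []      []      []      = refl
⊕-split (false ∷ x) (false ∷ y) (false ∷ s) = cong (false ∷_) (⊕-split x y s)
⊕-split (false ∷ x) (false ∷ y) (true  ∷ s) = cong (false ∷_) (⊕-split x y s)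
⊕-split (false ∷ x) (true  ∷ y) (false ∷ s) = cong (false ∷_) (⊕-split x y s)
⊕-split (false ∷ x) (true  ∷ y) (true  ∷ s) = cong (true  ∷_) (⊕-split x y s)
⊕-split (true  ∷ x) (false ∷ y) (false ∷ s) = cong (true  ∷_) (⊕-split x y s)
⊕-split (true  ∷ x) (false ∷ y) (true  ∷ s) = cong (false ∷_) (⊕-split x y s)
⊕-split (true  ∷ x) (true  ∷ y) (false ∷ s) = cong (true  ∷_) (⊕-split x y s)
⊕-split (true  ∷ x) (true  ∷ y) (true  ∷ s) = cong (true  ∷_) (⊕-split x y s)

x∈p─q⇒x∉q : ∀ {k} (p q : Subset k) {x} → x ∈ p ─ q → x ∉ q
x∈p─q⇒x∉q (inside ∷ p) (outside ∷ q) here ()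
x∈p─q⇒x∉q (_ ∷ p) (_ ∷ q) (there x∈p─q) (there x∈q) = x∈p─q⇒x∉q p q x∈p─q x∈q

p⊆q∪r⇒p─r⊆q : ∀ {k} {p q r : Subset k} → p ⊆ q ∪ r → p ─ r ⊆ q
p⊆q∪r⇒p─r⊆q {p = p} {q} {r} p⊆q∪r x∈p─r =
  [ id , (λ x∈r → contradiction x∈r (x∈p─q⇒x∉q p r x∈p─r)) ] (x∈p∪q⁻ q r (p⊆q∪r (p─q⊆p p r x∈p─r)))

Comparable : ∀ {a ℓ} {A : Set a} → Rel A ℓ → Rel A ℓ
Comparable _≤_ x y = x ≤ y ⊎ y ≤ x

module _ {a ℓ} {A : Set a} {_≤_ : Rel A ℓ} (≤-refl : Reflexive _≤_) (≤-trans : Transitive _≤_) where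

  chain-maximum : ∀ x xs → AllPairs (Comparable _≤_) (x ∷ xs) →
                  ∃ λ M → M ∈ₗ x ∷ xs × All (_≤ M) (x ∷ xs)
  chain-maximum x []       _ = x , here refl , ≤-refl ∷ []
  chain-maximum x (y ∷ ys) (x~ys ∷ comparable)
    with M , M∈ , ys≤M ← chain-maximum y ys comparable
    with All.lookup x~ys M∈
  ... | inj₁ x≤M = M , there M∈ , x≤M ∷ ys≤M
  ... | inj₂ M≤x = x , here refl , ≤-refl ∷ All.map (λ z≤M → ≤-trans z≤M M≤x) ys≤M

chain-minimum : ∀ {a ℓ} {A : Set a} {_≤_ : Rel A ℓ} → Reflexive _≤_ → Transitive _≤_ →
                ∀ x xs → AllPairs (Comparable _≤_) (x ∷ xs) →
                ∃ λ m → m ∈ₗ x ∷ xs × All (m ≤_) (x ∷ xs)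
chain-minimum {_≤_ = _≤_} ≤-refl ≤-trans x xs comparable =
  chain-maximum {_≤_ = flip _≤_} ≤-refl (flip ≤-trans) x xs (AllPairs.map swap comparable)

module Ideals {n : ℕ} (_≼_ : Rel (Fin n) 0ℓ) (po : IsPartialOrder _≡_ _≼_) (_≼?_ : Decidable _≼_)
  where
  open Poset _≼_ _≼?_
  open IsPartialOrder po using () renaming (refl to ≼-refl; trans to ≼-trans)

  isIdeal? : (J : Subset n) → Dec (IsIdeal J)
  isIdeal? J = all? λ a → all? λ b → (a ∈? J) →-dec ((b ≼? a) →-dec (b ∈? J))

  -- ¬ ∀ ⇒ ∃ ¬ holds constructively here because there are finitely many subsets
  avoidingIdeal : ∀ {r a} → InPtilde r a → ∃ λ J → IdealOfSize r J × a ∉ J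
  avoidingIdeal {r} {a} (_ , ¬∀J→a∈J)
    with anySubset? (λ J → (isIdeal? J ×-dec (∣ J ∣ ≟ r)) ×-dec ¬? (a ∈? J))
  ... | yes ∃J = ∃J
  ... | no ∄J = contradiction
    (λ J J-ideal → decidable-stable (a ∈? J) (λ a∉J → ∄J (J , J-ideal , a∉J))) ¬∀J→a∈J

  ⟨⟩-least : ∀ {X J} → IsIdeal J → X ⊆ J → ⟨ X ⟩ ⊆ J
  ⟨⟩-least {X} {J} J-ideal X⊆J {b} b∈⟨X⟩
    with a , Xₐ≡true , b≼a ← toWitness {a? = any? λ a → (lookup X a ≟ᵇ true) ×-dec (b ≼? a)}
           (Equivalence.from T-≡ (trans (sym (lookup∘tabulate _ b)) ([]=⇒lookup b∈⟨X⟩)))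
    = J-ideal a b (X⊆J (lookup⇒[]= a X Xₐ≡true)) b≼a

  ⊆ideal⇒InBall : ∀ {r J b} → IdealOfSize r J → b ⊆ J → InBall r b
  ⊆ideal⇒InBall (J-ideal , refl) b⊆J = p⊆q⇒∣p∣≤∣q∣ (⟨⟩-least J-ideal b⊆J)

  chain⇒ideals : ∀ {r c cs} → IsChainIn~P r (c ∷ cs) →
                 ∃₂ λ J J′ → IdealOfSize r J × IdealOfSize r J′ × length (c ∷ cs) + r ≤ ∣ J ∪ J′ ∣
  chain⇒ideals {c = c} {cs} (distinct , inP̃ , comparable)
    with M , M∈chain , chain≼M ← chain-maximum ≼-refl ≼-trans c cs comparable
       | m , m∈chain , m≼chain ← chain-minimum ≼-refl ≼-trans c cs comparable
    with (J , J-ideal , M∈J) , _ ← All.lookup inP̃ M∈chain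
       | J′ , J′-ideal , m∉J′ ← avoidingIdeal (All.lookup inP̃ m∈chain)
    = J , J′ , J-ideal , J′-ideal ,
      subst (λ e → length (c ∷ cs) + e ≤ ∣ J ∪ J′ ∣) (proj₂ J′-ideal)
        (length+∣p∣≤∣q∣ (c ∷ cs) (q⊆p∪q J J′) distinct (All.map (p⊆p∪q J′) chain⊆J) chain∉J′)
    where
    chain⊆J : All (_∈ J) (c ∷ cs)
    chain⊆J = All.map (proj₁ J-ideal M _ M∈J) chain≼M
    chain∉J′ : All (_∉ J′) (c ∷ cs)
    chain∉J′ = All.map (λ m≼x x∈J′ → m∉J′ (proj₁ J′-ideal _ m x∈J′ m≼x)) m≼chain

  errorCorrecting⇒size≤ : ∀ {r N J J′} (C : Fin N → F n) → Injective _≡_ _≡_ C →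
                          ErrorCorrecting r C → IdealOfSize r J → IdealOfSize r J′ →
                          N ≤ 2 ^ (n ∸ ∣ J ∪ J′ ∣)
  errorCorrecting⇒size≤ {r} {J = J} {J′} C C-injective C-correcting J-ideal J′-ideal =
    ≮⇒≥ λ 2^[n∸∣J∪J′∣]<N →
    let i , j , i<j , agree = pigeonhole-outside (J ∪ J′) C 2^[n∸∣J∪J′∣]<N
        d = C i ⊕ C j
        d∩J′∈ball : InBall r (d ∩ J′)
        d∩J′∈ball = ⊆ideal⇒InBall J′-ideal (p∩q⊆q d J′)
        d─J′∈ball : InBall r (d ─ J′)
        d─J′∈ball = ⊆ideal⇒InBall J-ideal (p⊆q∪r⇒p─r⊆q (⊕-⊆ {x = C i} {C j} agree))
    in <⇒≢ᶠ i<j (C-injective (proj₁ (C-correcting i j (d ∩ J′) (d ─ J′) d∩J′∈ball d─J′∈ball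
                                       (⊕-split (C i) (C j) J′))))

lemma6 : (n : ℕ) (_≼_ : Rel (Fin n) 0ℓ) → IsPartialOrder _≡_ _≼_ → (_≼?_ : Decidable _≼_) →
    (r m : ℕ) → r ≤ m → m ≤ n →
    (C : Fin (2 ^ (n ∸ m)) → F n) → Injective _≡_ _≡_ C →
    Poset.ErrorCorrecting _≼_ _≼?_ r C →
    (cs : List (Fin n)) → Poset.IsChainIn~P _≼_ _≼?_ r cs → length cs ≤ m ∸ r
lemma6 _ _ _ _ _ _ _ _ _ _ _ [] _ = z≤n
lemma6 n _≼_ po _≼?_ r m _ _ C C-injective C-correcting (c ∷ cs) chain
  with J , J′ , J-ideal , J′-ideal , length+r≤∣J∪J′∣ ← Ideals.chain⇒ideals _≼_ po _≼?_ chain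
  = m+n≤o⇒m≤o∸n (length (c ∷ cs)) (≤-trans length+r≤∣J∪J′∣ ∣J∪J′∣≤m)
  where
  open Ideals _≼_ po _≼?_

  2^[n∸m]≤2^[n∸∣J∪J′∣] : 2 ^ (n ∸ m) ≤ 2 ^ (n ∸ ∣ J ∪ J′ ∣)
  2^[n∸m]≤2^[n∸∣J∪J′∣] = errorCorrecting⇒size≤ C C-injective C-correcting J-ideal J′-ideal

  ∣J∪J′∣≤m : ∣ J ∪ J′ ∣ ≤ m
  ∣J∪J′∣≤m = ∸-cancelʳ-≤ (∣p∣≤n (J ∪ J′)) (^-cancelʳ-≤ 2 (s≤s (s≤s z≤n)) 2^[n∸m]≤2^[n∸∣J∪J′∣])
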